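{- Let $\mathfrak g\in\{A_1\oplus A_1,A_2,C_2,G_2\}$ and let $L$ be one of the $\mathfrak g$-fundamental lattices $L_{\mathfrak g}(1,0)=J(F_{\mathfrak g}(1,0))$ or $L_{\mathfrak g}(0,1)=J(F_{\mathfrak g}(0,1))$. If $t$ covers $s$ in $L$ with cover colored $\gamma\in\{\alpha,\beta\}$, then $wt(s)+\gamma=wt(t)$. Hence each $\mathfrak g$-fundamental lattice satisfies the $\mathfrak g$-structure condition.
   Context: Simple roots $\alpha$ (short) and $\beta$ of $\mathfrak g$ (either labeling for $A_1\oplus A_1$, $A_2$); weights $p\omega_\alpha+q\omega_\beta$ are identified with $(p,q)\in\mathbb Z^2$: $\alpha=(2,0),\beta=(0,2)$ for $A_1\oplus A_1$; $\alpha=(2,-1),\beta=(-1,2)$ for $A_2$; $\alpha=(2,-1),\beta=(-2,2)$ for $C_2$; $\alpha=(2,-1),\beta=(-3,2)$ for $G_2$. Fundamental posets $F_{\mathfrak g}(1,0)$, $F_{\mathfrak g}(0,1)$ (vertex-colored posets; $u\lessdot v$ means $v$ covers $u$): $A_1\oplus A_1$: $F(1,0)$ is one element colored $\alpha$, $F(0,1)$ one element colored $\beta$. $A_2$: $F(1,0)$: $z_2\lessdot z_1$ colored $\beta,\alpha$; $F(0,1)$: $w_2\lessdot w_1$ colored $\alpha,\beta$. $C_2$: $F(1,0)$: chain $z_3\lessdot z_2\lessdot z_1$ colored $\alpha,\beta,\alpha$; $F(0,1)$: chain $w_4\lessdot w_3\lessdot w_2\lessdot w_1$ colored $\beta,\alpha,\alpha,\beta$.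 $G_2$: $F(1,0)$: chain $z_6\lessdot\cdots\lessdot z_1$ colored $z_6:\alpha,z_5:\beta,z_4:\alpha,z_3:\alpha,z_2:\beta,z_1:\alpha$; $F(0,1)$: $a_1,\dots,a_{10}$ with covers $a_1\lessdot a_2\lessdot a_3$, $a_3\lessdot a_4$, $a_3\lessdot a_6$, $a_4\lessdot a_5$, $a_4\lessdot a_7$, $a_6\lessdot a_7$, $a_5\lessdot a_8$, $a_7\lessdot a_8$, $a_8\lessdot a_9\lessdot a_{10}$, with $a_1,a_4,a_7,a_{10}$ colored $\beta$ and the rest colored $\alpha$. $L=J(F)$: order ideals ordered by inclusion; a cover $s\subset t$ with $t\setminus s=\{u\}$ gets the color of $u$. For $s\in L$ and color $\gamma$, $\mathrm{comp}_\gamma(s)$ is the connected component of $s$ in the graph on $L$ whose edges are the $\gamma$-colored covers; $\rho_\gamma(s)=|s|-\min_{u\in\mathrm{comp}_\gamma(s)}|u|$, $l_\gamma(s)=\max_{u\in\mathrm{comp}_\gamma(s)}|u|-\min_{u\in\mathrm{comp}_\gamma(s)}|u|$, $wt(s)=(2\rho_\alpha(s)-l_\alpha(s),2\rho_\beta(s)-l_\beta(s))$. -}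

module Defs where

open import Data.Bool using (Bool; true; false)
open import Data.Nat using (ℕ; zero; suc; _∸_; _⊓_; _⊔_)
open import Data.Integer using (ℤ; +_; -[1+_]; _-_) renaming (_+_ to _+ℤ_; _*_ to _*ℤ_)
open import Data.Fin using (Fin; #_)
open import Data.Fin.Subset using (Subset; _∈_; _∉_; _∪_; ⁅_⁆; ∣_∣)
open import Data.Fin.Subset.Properties using (_∈?_)
open import Data.Fin.Properties using (any?)
open import Data.Vec using (Vec; []; _∷_; lookup)
import Data.Vec as Vec
open import Data.Vec.Properties using (≡-dec)
open import Data.List using (List; []; _∷_; _++_; map; filter; length; foldr)
open import Data.List.Relation.Unary.All using (All)
open import Data.List.Relation.Unary.All.Properties using ()
import Data.List.Relation.Unary.All as All
import Data.List.Relation.Unary.Any as Any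
open import Data.Product using (Σ; ∃; _×_; _,_; proj₁; proj₂)
open import Data.Sum using (_⊎_)
open import Relation.Binary.PropositionalEquality using (_≡_; refl)
open import Relation.Binary.Definitions using (DecidableEquality)
open import Relation.Nullary using (Dec; yes; no; ¬_; ¬?; _×-dec_; _→-dec_; _⊎-dec_)
import Data.Bool.Properties as BoolP

data Color : Set where
  α β : Color

_≟c_ : DecidableEquality Color
α ≟c α = yes refl
α ≟c β = no λ ()
β ≟c α = no λ ()
β ≟c β = yes refl

data Alg : Set where
  A1⊕A1 A2 C2 G2 : Alg

data Fund : Set where
  w10 w01 : Fund

-- weights p ω_α + q ω_β identified with (p , q)
Weight : Set
Weight = ℤ × ℤ

_+w_ : Weight → Weight → Weight
(a , b) +w (c , d) = (a +ℤ c , b +ℤ d)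

-- simple roots in fundamental-weight coordinates
root : Alg → Color → Weight
root A1⊕A1 α = (+ 2 , + 0)
root A1⊕A1 β = (+ 0 , + 2)
root A2    α = (+ 2 , -[1+ 0 ])
root A2    β = (-[1+ 0 ] , + 2)
root C2    α = (+ 2 , -[1+ 0 ])
root C2    β = (-[1+ 1 ] , + 2)
root G2    α = (+ 2 , -[1+ 0 ])
root G2    β = (-[1+ 2 ] , + 2)

-- Finite vertex-coloured posets, given by their elements Fin size,
-- colouring and list of covering pairs (u , v) meaning u ⋖ v.

record CPoset : Set where
  field
    size   : ℕ
    color  : Fin size → Color
    covers : List (Fin size × Fin size)
open CPoset public

mk : (n : ℕ) → Vec Color n → List (Fin n × Fin n) → CPoset
mk n cs cv = record { size = n ; color = lookup cs ; covers = cv }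

-- Elements z_i / w_i / a_i are indexed by Fin with z_i ↦ # (i - 1).
fundPoset : Alg → Fund → CPoset
fundPoset A1⊕A1 w10 = mk 1 (α ∷ []) []
fundPoset A1⊕A1 w01 = mk 1 (β ∷ []) []
fundPoset A2 w10 = mk 2 (α ∷ β ∷ []) ((# 1 , # 0) ∷ [])
fundPoset A2 w01 = mk 2 (β ∷ α ∷ []) ((# 1 , # 0) ∷ [])
fundPoset C2 w10 = mk 3 (α ∷ β ∷ α ∷ []) ((# 1 , # 0) ∷ (# 2 , # 1) ∷ [])
fundPoset C2 w01 = mk 4 (β ∷ α ∷ α ∷ β ∷ [])
                        ((# 1 , # 0) ∷ (# 2 , # 1) ∷ (# 3 , # 2) ∷ [])
fundPoset G2 w10 = mk 6 (α ∷ β ∷ α ∷ α ∷ β ∷ α ∷ [])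
                        ((# 1 , # 0) ∷ (# 2 , # 1) ∷ (# 3 , # 2) ∷
                         (# 4 , # 3) ∷ (# 5 , # 4) ∷ [])
fundPoset G2 w01 = mk 10 (β ∷ α ∷ α ∷ β ∷ α ∷ α ∷ β ∷ α ∷ α ∷ β ∷ [])
  ( (# 0 , # 1)
  ∷ (# 1 , # 2)
  ∷ (# 2 , # 3)
  ∷ (# 2 , # 5)
  ∷ (# 3 , # 4)
  ∷ (# 3 , # 6)
  ∷ (# 5 , # 6)
  ∷ (# 4 , # 7)
  ∷ (# 6 , # 7)
  ∷ (# 7 , # 8)
  ∷ (# 8 , # 9)
  ∷ [])

module _ (F : CPoset) where
  private n = size F

  -- s is an order ideal: down-closed (closure under the covering
  -- relation is equivalent to closure under its reflexive-transitive
  -- closure, the order of F).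
  IsIdeal : Subset n → Set
  IsIdeal s = All (λ p → proj₂ p ∈ s → proj₁ p ∈ s) (covers F)

  isIdeal? : (s : Subset n) → Dec (IsIdeal s)
  isIdeal? s = All.all? (λ p → (proj₂ p ∈? s) →-dec (proj₁ p ∈? s)) (covers F)

  ColCover : Color → Subset n → Subset n → Set
  ColCover γ s t = ∃ λ u → u ∉ s × t ≡ s ∪ ⁅ u ⁆ × color F u ≡ γ

  colCover? : (γ : Color) (s t : Subset n) → Dec (ColCover γ s t)
  colCover? γ s t = any? λ u →
    (¬? (u ∈? s)) ×-dec (≡-dec BoolP._≟_ t (s ∪ ⁅ u ⁆) ×-dec (color F u ≟c γ))

  allSubsets : (m : ℕ) → List (Subset m)
  allSubsets zero = [] ∷ []
  allSubsets (suc m) = map (Vec._∷_ true) (allSubsets m) ++ map (Vec._∷_ false) (allSubsets m)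

  ideals : List (Subset n)
  ideals = filter isIdeal? (allSubsets n)


  Edge : Color → Subset n → Subset n → Set
  Edge γ x y = ColCover γ x y ⊎ ColCover γ y x

  edge? : (γ : Color) (x y : Subset n) → Dec (Edge γ x y)
  edge? γ x y = colCover? γ x y ⊎-dec colCover? γ y x

  step : Color → List (Subset n) → List (Subset n)
  step γ S = S ++ filter (λ v → Any.any? (λ x → edge? γ x v) S) ideals

  iter : ℕ → Color → List (Subset n) → List (Subset n)
  iter zero    γ S = S
  iter (suc k) γ S = iter k γ (step γ S)

  -- comp_γ(s): ideals reachable from s by paths of γ-coloured covers.
  -- A path in a graph on |L| vertices needs at most |L| steps.
  comp : Color → Subset n → List (Subset n)
  comp γ s = iter (length ideals) γ (s ∷ [])

  minSize maxSize : Color → Subset n → ℕ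
  minSize γ s = foldr (λ u m → ∣ u ∣ ⊓ m) ∣ s ∣ (comp γ s)
  maxSize γ s = foldr (λ u m → ∣ u ∣ ⊔ m) ∣ s ∣ (comp γ s)

  ρ l : Color → Subset n → ℕ
  ρ γ s = ∣ s ∣ ∸ minSize γ s
  l γ s = maxSize γ s ∸ minSize γ s

  wtc : Color → Subset n → ℤ
  wtc γ s = (+ 2) *ℤ (+ ρ γ s) - (+ l γ s)

  wt : Subset n → Weight
  wt s = (wtc α s , wtc β s)

module Submission where

-- The lattices are eight explicit finite objects, so the proof is a verified
-- computation; the work lies in making it correct and feasible.
--  * Every order ideal occurs in the enumeration `ideals F`.
--  * wt(s) uses only the least and greatest size of an ideal in comp_γ(s),
--    so it depends only on the members of the list `comp γ s`.
--  * `comp` re-adds known ideals and always runs |L| rounds; a duplicate-free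
--    breadth-first search stopping at its first empty frontier yields a list
--    with the same members, hence the same weights, much faster.
--  * With these weights we tabulate wt over L and check by evaluation that
--    every cover between two table entries raises the weight by the root of
--    its colour; the theorem follows for each of the eight lattices.

open import Defs
open import Data.Bool using (true; false)
import Data.Bool.Properties as Bool
open import Data.Fin.Properties using (all?)
open import Data.Fin.Subset using (Subset; _∪_; ⁅_⁆; _∉_; ∣_∣)
open import Data.Fin.Subset.Properties using (_∈?_)
open import Data.Integer using (ℤ; +_; _-_) renaming (_*_ to _*ℤ_; _≟_ to _≟ℤ_)
open import Data.List using (List; []; _∷_; _++_; map; filter; length; foldr)
open import Data.List.Membership.Propositional using (_∈_)
open import Data.List.Membership.Propositional.Properties
  using (∈-map⁺; ∈-filter⁺; ∈-filter⁻; ∈-++⁺ˡ; ∈-++⁺ʳ; ∈-++⁻)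
import Data.List.Membership.DecPropositional as DecMembership
open import Data.List.Properties using (++-identityʳ)
open import Data.List.Relation.Binary.Subset.Propositional using (_⊆_)
open import Data.List.Relation.Binary.Subset.Propositional.Properties
  using (Any-resp-⊆; ++⁺; filter⁺′)
open import Data.List.Relation.Unary.All as All using (All)
open import Data.List.Relation.Unary.Any as Any using (Any; here; there)
open import Data.Nat using (ℕ; zero; suc; _≤_; _∸_; _⊓_; _⊔_)
open import Data.Nat.Properties
  using (≤-refl; ≤-trans; ≤-antisym; ⊓-glb; ⊔-lub; m⊓n≤m; m⊓n≤n; m≤m⊔n; m≤n⊔m)
open import Data.Product using (_×_; _,_; proj₂)
open import Data.Product.Properties using (≡-dec)
open import Data.Sum using (inj₁; inj₂)
open import Data.Vec using ([]; _∷_)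
open import Data.Vec.Properties using () renaming (≡-dec to ≡-decVec)
open import Relation.Binary.PropositionalEquality
  using (_≡_; refl; sym; trans; cong; cong₂; subst; module ≡-Reasoning)
open import Relation.Nullary using (Dec; yes; no; ¬_; ¬?; _×-dec_; _→-dec_)
open import Relation.Nullary.Decidable using (True; toWitness)

infix 4 _≈_
_≈_ : {A : Set} → List A → List A → Set
xs ≈ ys = xs ⊆ ys × ys ⊆ xs

≈-refl : {A : Set} (xs : List A) → xs ≈ xs
≈-refl xs = (λ x∈ → x∈) , (λ x∈ → x∈)

_≟w_ : (v w : Weight) → Dec (v ≡ w)
_≟w_ = ≡-dec _≟ℤ_ _≟ℤ_

∈-allSubsets : (F : CPoset) {m : ℕ} (s : Subset m) → s ∈ allSubsets F m
∈-allSubsets F []          = here refl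
∈-allSubsets F (true ∷ s)  = ∈-++⁺ˡ (∈-map⁺ (true ∷_) (∈-allSubsets F s))
∈-allSubsets F (false ∷ s) = ∈-++⁺ʳ _ (∈-map⁺ (false ∷_) (∈-allSubsets F s))

ideal∈ideals : (F : CPoset) {s : Subset (size F)} → IsIdeal F s → s ∈ ideals F
ideal∈ideals F {s} s-ideal = ∈-filter⁺ (isIdeal? F) (∈-allSubsets F s) s-ideal

-- The least and greatest value of f over a list, with c as a default, only
-- depend on the members of the list: they are a greatest lower bound and a
-- least upper bound respectively.

module Extremes {A : Set} (f : A → ℕ) (c : ℕ) where

  minOf maxOf : List A → ℕ
  minOf = foldr (λ x m → f x ⊓ m) c
  maxOf = foldr (λ x m → f x ⊔ m) c

  minOf≤default : ∀ xs → minOf xs ≤ c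
  minOf≤default []       = ≤-refl
  minOf≤default (x ∷ xs) = ≤-trans (m⊓n≤n (f x) _) (minOf≤default xs)

  minOf≤member : ∀ {x xs} → x ∈ xs → minOf xs ≤ f x
  minOf≤member {xs = y ∷ _}  (here refl) = m⊓n≤m (f y) _
  minOf≤member {xs = y ∷ _}  (there x∈)  = ≤-trans (m⊓n≤n (f y) _) (minOf≤member x∈)

  minOf-greatest : ∀ {z} xs → z ≤ c → (∀ {x} → x ∈ xs → z ≤ f x) → z ≤ minOf xs
  minOf-greatest []       z≤c z≤f = z≤c
  minOf-greatest (x ∷ xs) z≤c z≤f =
    ⊓-glb (z≤f (here refl)) (minOf-greatest xs z≤c (λ x∈ → z≤f (there x∈)))

  minOf-antitone : ∀ {xs ys} → xs ⊆ ys → minOf ys ≤ minOf xs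
  minOf-antitone {xs} {ys} xs⊆ys =
    minOf-greatest xs (minOf≤default ys) (λ x∈ → minOf≤member (xs⊆ys x∈))

  minOf-cong : ∀ {xs ys} → xs ≈ ys → minOf xs ≡ minOf ys
  minOf-cong (xs⊆ys , ys⊆xs) = ≤-antisym (minOf-antitone ys⊆xs) (minOf-antitone xs⊆ys)

  default≤maxOf : ∀ xs → c ≤ maxOf xs
  default≤maxOf []       = ≤-refl
  default≤maxOf (x ∷ xs) = ≤-trans (default≤maxOf xs) (m≤n⊔m (f x) _)

  member≤maxOf : ∀ {x xs} → x ∈ xs → f x ≤ maxOf xs
  member≤maxOf {xs = y ∷ _} (here refl) = m≤m⊔n (f y) _
  member≤maxOf {xs = y ∷ _} (there x∈)  = ≤-trans (member≤maxOf x∈) (m≤n⊔m (f y) _)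

  maxOf-least : ∀ {z} xs → c ≤ z → (∀ {x} → x ∈ xs → f x ≤ z) → maxOf xs ≤ z
  maxOf-least []       c≤z f≤z = c≤z
  maxOf-least (x ∷ xs) c≤z f≤z =
    ⊔-lub (f≤z (here refl)) (maxOf-least xs c≤z (λ x∈ → f≤z (there x∈)))

  maxOf-monotone : ∀ {xs ys} → xs ⊆ ys → maxOf xs ≤ maxOf ys
  maxOf-monotone {xs} {ys} xs⊆ys =
    maxOf-least xs (default≤maxOf ys) (λ x∈ → member≤maxOf (xs⊆ys x∈))

  maxOf-cong : ∀ {xs ys} → xs ≈ ys → maxOf xs ≡ maxOf ys
  maxOf-cong (xs⊆ys , ys⊆xs) = ≤-antisym (maxOf-monotone xs⊆ys) (maxOf-monotone ys⊆xs)

coordinate : (size lo hi : ℕ) → ℤ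
coordinate k lo hi = (+ 2) *ℤ (+ (k ∸ lo)) - (+ (hi ∸ lo))

module _ {n : ℕ} where
  open Extremes {Subset n} ∣_∣

  coordinateFrom : List (Subset n) → Subset n → ℤ
  coordinateFrom C s = coordinate (∣ s ∣) (minOf (∣ s ∣) C) (maxOf (∣ s ∣) C)

  wtFrom : (Color → List (Subset n)) → Subset n → Weight
  wtFrom C s = coordinateFrom (C α) s , coordinateFrom (C β) s

  wtFrom-cong : ∀ {C D} s → (∀ γ → C γ ≈ D γ) → wtFrom C s ≡ wtFrom D s
  wtFrom-cong {C} {D} s C≈D = cong₂ _,_ (coordinate-cong α) (coordinate-cong β)
    where
    coordinate-cong : ∀ γ → coordinateFrom (C γ) s ≡ coordinateFrom (D γ) s
    coordinate-cong γ = cong₂ (coordinate (∣ s ∣))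
      (minOf-cong (∣ s ∣) (C≈D γ)) (maxOf-cong (∣ s ∣) (C≈D γ))

module FastComponents (F : CPoset) (I : List (Subset (size F))) where
  open DecMembership (≡-decVec {n = size F} Bool._≟_) using () renaming (_∈?_ to _∈?ᴸ_)

  joined? : (γ : Color) (S : List (Subset (size F))) (v : Subset (size F)) →
            Dec (Any (λ x → Edge F γ x v) S)
  joined? γ S v = Any.any? (λ x → edge? F γ x v) S

  fresh? : (γ : Color) (S : List (Subset (size F))) (v : Subset (size F)) →
           Dec (¬ (v ∈ S) × Any (λ x → Edge F γ x v) S)
  fresh? γ S v = ¬? (v ∈?ᴸ S) ×-dec joined? γ S v

  frontier : Color → List (Subset (size F)) → List (Subset (size F))
  frontier γ S = filter (fresh? γ S) I

  closure : ℕ → Color → List (Subset (size F)) → List (Subset (size F))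
  closure zero    γ S = S
  closure (suc k) γ S with frontier γ S
  ... | []     = S
  ... | v ∷ vs = closure k γ (S ++ v ∷ vs)

  fastWt : Subset (size F) → Weight
  fastWt s = wtFrom (λ γ → closure (length I) γ (s ∷ [])) s

module _ (F : CPoset) (γ : Color) where
  open FastComponents F (ideals F)
  open DecMembership (≡-decVec {n = size F} Bool._≟_) using () renaming (_∈?_ to _∈?ᴸ_)

  Ideals : Set
  Ideals = List (Subset (size F))

  step⊆grow : ∀ {S T : Ideals} → S ⊆ T → step F γ S ⊆ T ++ frontier γ T
  step⊆grow {S} {T} S⊆T {x} x∈ with ∈-++⁻ S x∈
  ... | inj₁ x∈S = ∈-++⁺ˡ (S⊆T x∈S)
  ... | inj₂ x∈new with ∈-filter⁻ (joined? γ S) {xs = ideals F} x∈new | x ∈?ᴸ T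
  ...   | _        , _      | yes x∈T = ∈-++⁺ˡ x∈T
  ...   | x∈ideals , joined | no  x∉T =
    ∈-++⁺ʳ T (∈-filter⁺ (fresh? γ T) x∈ideals (x∉T , Any-resp-⊆ S⊆T joined))

  grow⊆step : ∀ {S T : Ideals} → T ⊆ S → T ++ frontier γ T ⊆ step F γ S
  grow⊆step {S} {T} T⊆S =
    ++⁺ T⊆S (filter⁺′ (fresh? γ T) (joined? γ S)
                      (λ fresh → Any-resp-⊆ T⊆S (proj₂ fresh)) {ideals F} (λ x∈ → x∈))

  step≈grow : ∀ {S T : Ideals} → S ≈ T → step F γ S ≈ T ++ frontier γ T
  step≈grow (S⊆T , T⊆S) = step⊆grow S⊆T , grow⊆step T⊆S

  iter-closed : ∀ k {S T : Ideals} → frontier γ T ≡ [] → S ≈ T → iter F k γ S ≈ T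
  iter-closed zero    closed S≈T = S≈T
  iter-closed (suc k) {S} {T} closed S≈T =
    iter-closed k closed (subst (step F γ S ≈_) grow-T≡T (step≈grow S≈T))
    where
    grow-T≡T : T ++ frontier γ T ≡ T
    grow-T≡T = trans (cong (T ++_) closed) (++-identityʳ T)

  iter≈closure : ∀ k {S T : Ideals} → S ≈ T → iter F k γ S ≈ closure k γ T
  iter≈closure zero    S≈T = S≈T
  iter≈closure (suc k) {S} {T} S≈T with frontier γ T in eq
  ... | []     = iter-closed (suc k) eq S≈T
  ... | v ∷ vs = iter≈closure k (subst (step F γ S ≈_) (cong (T ++_) eq) (step≈grow S≈T))

-- wt F s is wtFrom (λ γ → comp F γ s) s by definition, and comp F γ s is
-- `iter` run for |L| rounds from s ∷ [].
wt≡fastWt : (F : CPoset) (s : Subset (size F)) → wt F s ≡ FastComponents.fastWt F (ideals F) s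
wt≡fastWt F s = wtFrom-cong s (λ γ → iter≈closure F γ (length (ideals F)) (≈-refl (s ∷ [])))

-- Tables of weights of ideals.  Tabulating evaluates each weight once, while
-- the check below looks at every pair of entries.

WeightTable : CPoset → Set
WeightTable F = List (Subset (size F) × Weight)

weightTable : (F : CPoset) → List (Subset (size F)) → WeightTable F
weightTable F I = map (λ s → s , FastComponents.fastWt F I s) I

module _ (F : CPoset) (r : Color → Weight) where

  RespectsCovers : WeightTable F → Set
  RespectsCovers tab =
    All (λ (s , ws) → All (λ (t , wt′) →
      ∀ u → u ∉ s → t ≡ s ∪ ⁅ u ⁆ → (ws +w r (color F u)) ≡ wt′) tab) tab

  respectsCovers? : (tab : WeightTable F) → Dec (RespectsCovers tab)
  respectsCovers? tab =
    All.all? (λ (s , ws) → All.all? (λ (t , wt′) → all? λ u →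
      ¬? (u ∈? s) →-dec (≡-decVec Bool._≟_ t (s ∪ ⁅ u ⁆) →-dec
        ((ws +w r (color F u)) ≟w wt′))) tab) tab

  structureCondition : RespectsCovers (weightTable F (ideals F)) →
    ∀ γ s t → IsIdeal F s → IsIdeal F t → ColCover F γ s t → (wt F s +w r γ) ≡ wt F t
  structureCondition respects γ s t s-ideal t-ideal (u , u∉s , refl , refl) = begin
    wt F s +w r (color F u)     ≡⟨ cong (_+w r (color F u)) (wt≡fastWt F s) ⟩
    fastWt s +w r (color F u)   ≡⟨ All.lookup (All.lookup respects (entry s-ideal)) (entry t-ideal) u u∉s refl ⟩
    fastWt (s ∪ ⁅ u ⁆)          ≡⟨ sym (wt≡fastWt F (s ∪ ⁅ u ⁆)) ⟩
    wt F (s ∪ ⁅ u ⁆)            ∎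
    where
    open FastComponents F (ideals F) using (fastWt)
    open ≡-Reasoning
    entry : ∀ {x} → IsIdeal F x → (x , fastWt x) ∈ weightTable F (ideals F)
    entry x-ideal = ∈-map⁺ (λ x → x , fastWt x) (ideal∈ideals F x-ideal)

fundamentalTablesRespectCovers : (g : Alg) (w : Fund) →
  True (respectsCovers? (fundPoset g w) (root g)
                        (weightTable (fundPoset g w) (ideals (fundPoset g w))))
fundamentalTablesRespectCovers A1⊕A1 w10 = _
fundamentalTablesRespectCovers A1⊕A1 w01 = _
fundamentalTablesRespectCovers A2    w10 = _
fundamentalTablesRespectCovers A2    w01 = _
fundamentalTablesRespectCovers C2    w10 = _
fundamentalTablesRespectCovers C2    w01 = _
fundamentalTablesRespectCovers G2    w10 = _
fundamentalTablesRespectCovers G2    w01 = _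

lemma4p1 : (g : Alg) (w : Fund) (γ : Color)
           (s t : Subset (size (fundPoset g w))) →
           IsIdeal (fundPoset g w) s → IsIdeal (fundPoset g w) t →
           ColCover (fundPoset g w) γ s t →
           (wt (fundPoset g w) s +w root g γ) ≡ wt (fundPoset g w) t
lemma4p1 g w =
  structureCondition (fundPoset g w) (root g) (toWitness (fundamentalTablesRespectCovers g w))
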